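{- Let $\mathcal T$ be a basic theory and $\zeta\Rightarrow_r\eta$ a graded implication. If there is a forest proof of $\zeta\Rightarrow_r\eta$ from $\mathcal T$, then there is a forest proof of $\zeta\Rightarrow_r\eta$ from $\mathcal T$ with the following properties. For every variable $\phi$ and every root $L$: $\phi\in L$ only if $\phi$ occurs positively in $\zeta$, and $\neg\phi\in L$ only if $\phi$ occurs negatively in $\zeta$. For every variable $\phi$ and every leaf $L$ (terminal clause): $\phi\in L$ only if $\phi$ occurs positively in $\eta$, and $\neg\phi\in L$ only if $\phi$ occurs negatively in $\eta$.
   Context: Boolean formulas are built from countably many variables and $\bot,\top$ via $\wedge,\vee,\neg$; a variable occurs positively (negatively) in a formula if it has an occurrence within the scope of an even (odd) number of negation signs. $\alpha,\beta$ are Boolean equivalent if $\alpha\to\beta$ and $\beta\to\alpha$ are classical tautologies. A graded implication is $\alpha\Rightarrow_d\beta$, $d\in\mathbb R^+=[0,\infty)$. A literal is $\phi$ or $\neg\phi$ for a variable $\phi$; a clause is a finite set of literals, inconsistent if it contains some $\phi$ and $\neg\phi$, consistent otherwise; a clause set is a finite set of clauses. For a clause set $B$, $f(B)=\bigvee_{L\in B}\bigwedge L$ (empty conjunction $=\top$, empty disjunction $=\bot$); $B$ is a clause set for $\alpha$ if $f(B)$ is Boolean equivalent to $\alpha$. A basic implication is $\lambda_1\wedge\dots\wedge\lambda_n\Rightarrow_d\bigvee_{i=1}^l\bigwedge_{j=1}^{k_i}\mu_{ij}$ with $n\ge1$, $l\ge0$, $k_i\ge1$, where $\{\lambda_1,\dots,\lambda_n\}$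 and all $\{\mu_{i1},\dots,\mu_{ik_i}\}$ are consistent clauses; a basic theory is a set of basic implications. A proof forest is a finite directed forest (each component a rooted tree, edges directed from father to child) with a weight in $\mathbb R^+$ on each edge, each node labelled by a clause or by the symbol $\divideontimes$ (nodes identified with labels). A branch is a maximal root-to-leaf path; its length is $0$ if it contains $\divideontimes$ and otherwise the sum of its edge weights; the length of the forest is the maximum length of its branches. A forest proof of $\zeta\Rightarrow_r\eta$ from a basic theory $\mathcal T$ is a proof forest such that: (T1) there is a clause set $B_\zeta$ for $\zeta$ such that each clause of $B_\zeta$ has a root that is a subset of it; (T2) there is a clause set $B_\eta$ for $\eta$ such that every terminal clause includes some clause of $B_\eta$; (T3) the length of the forest is at most $r$; (T4) for every non-terminal clause $L$, all edges from $L$ have the same weight $c$, and one of: (A) $c=0$ and $\mathcal T$ contains a basic implication $\lambda_1\wedge\dots\wedge\lambda_n\Rightarrow_0\bigvee_{i=1}^l\bigwedge_j\mu_{ij}$ with $\{\lambda_1,\dots,\lambda_n\}\subseteq L$ such that for each $i$ some child of $L$ is a clause $L'\subseteq\{\mu_{i1},\dots,\mu_{ik_i}\}\cup L$; (B) $c>0$ and $\mathcal T$ contains a basic implication $\lambda_1\wedge\dots\wedge\lambda_n\Rightarrow_c\bigvee_{i=1}^l\bigwedge_j\mu_{ij}$ with $\{\lambda_1,\dots,\lambda_n\}\subseteq L$ such that for each $i$ some child of $L$ is a clause $L'\subseteq\{\mu_{i1},\dots,\mu_{ik_i}\}$; (C) $c=0$, $L$ is inconsistent and $\divideontimes$ is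 the only child of $L$; (D) $c=0$ and for some variable $\phi$, $L$ has exactly two children, one consisting of $\phi$ together with a subset of $L$, the other of $\neg\phi$ together with a subset of $L$. -}

module Defs where

open import Data.Nat using (ℕ)
open import Data.Bool using (Bool; true; false; not; _∧_; _∨_)
open import Data.List using (List; []; _∷_; foldr; _++_)
open import Data.List.Membership.Propositional using (_∈_)
open import Data.List.Relation.Binary.Subset.Propositional using (_⊆_)
open import Data.Product using (Σ; ∃; ∃-syntax; _×_; _,_)
open import Data.Sum using (_⊎_)
open import Relation.Binary.PropositionalEquality using (_≡_)
open import Relation.Nullary using (¬_)

data Formula : Set where
  fvar : ℕ → Formula
  fbot ftop : Formula
  _∧ᶠ_ _∨ᶠ_ : Formula → Formula → Formula
  ¬ᶠ_ : Formula → Formula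

eval : (ℕ → Bool) → Formula → Bool
eval v (fvar x) = v x
eval v fbot = false
eval v ftop = true
eval v (a ∧ᶠ b) = eval v a ∧ eval v b
eval v (a ∨ᶠ b) = eval v a ∨ eval v b
eval v (¬ᶠ a) = not (eval v a)

BoolEquiv : Formula → Formula → Set
BoolEquiv α β = (v : ℕ → Bool) → eval v α ≡ eval v β

-- Occ p φ α : variable φ has an occurrence in α within the scope of an
-- even (p = true, "positively") or odd (p = false, "negatively") number
-- of negation signs.
data Occ : Bool → ℕ → Formula → Set where
  occ-var : ∀ {φ} → Occ true φ (fvar φ)
  occ-∧ˡ : ∀ {p φ a b} → Occ p φ a → Occ p φ (a ∧ᶠ b)
  occ-∧ʳ : ∀ {p φ a b} → Occ p φ b → Occ p φ (a ∧ᶠ b)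
  occ-∨ˡ : ∀ {p φ a b} → Occ p φ a → Occ p φ (a ∨ᶠ b)
  occ-∨ʳ : ∀ {p φ a b} → Occ p φ b → Occ p φ (a ∨ᶠ b)
  occ-¬ : ∀ {p φ a} → Occ (not p) φ a → Occ p φ (¬ᶠ a)

OccursPositively : ℕ → Formula → Set
OccursPositively = Occ true

OccursNegatively : ℕ → Formula → Set
OccursNegatively = Occ false

data Lit : Set where
  pos : ℕ → Lit
  neg : ℕ → Lit

Clause : Set
Clause = List Lit

ClauseSet : Set
ClauseSet = List Clause

Inconsistent : Clause → Set
Inconsistent L = ∃[ φ ] (pos φ ∈ L × neg φ ∈ L)

Consistent : Clause → Set
Consistent L = ¬ Inconsistent L

litF : Lit → Formula
litF (pos φ) = fvar φ
litF (neg φ) = ¬ᶠ fvar φ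

conjF : Clause → Formula
conjF = foldr (λ l acc → litF l ∧ᶠ acc) ftop

fB : ClauseSet → Formula
fB = foldr (λ L acc → conjF L ∨ᶠ acc) fbot

ClauseSetFor : ClauseSet → Formula → Set
ClauseSetFor B α = BoolEquiv (fB B) α

record Weights : Set₁ where
  field
    W        : Set
    0#       : W
    _+_      : W → W → W
    _≤_      : W → W → Set
    +-assoc      : ∀ x y z → (x + y) + z ≡ x + (y + z)
    +-comm       : ∀ x y → x + y ≡ y + x
    +-identityˡ  : ∀ x → 0# + x ≡ x
    ≤-refl   : ∀ {x} → x ≤ x
    ≤-trans  : ∀ {x y z} → x ≤ y → y ≤ z → x ≤ z
    ≤-antisym : ∀ {x y} → x ≤ y → y ≤ x → x ≡ y
    ≤-total  : ∀ x y → x ≤ y ⊎ y ≤ x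
    +-mono-≤ : ∀ {x y u v} → x ≤ y → u ≤ v → (x + u) ≤ (y + v)
    0≤       : ∀ x → 0# ≤ x

  -- x > 0 in the nonnegative setting
  Positive : W → Set
  Positive c = ¬ (c ≡ 0#)

module WithWeights (Wt : Weights) where
  open Weights Wt

  record GradedImp : Set where
    constructor _⇒[_]_
    field
      antecedent : Formula
      grade      : W
      consequent : Formula

  -- λ₁ ∧ … ∧ λₙ ⇒_d ⋁_i ⋀_j μ_ij
  record BasicImp : Set where
    field
      lhs    : Clause
      weight : W
      rhs    : List Clause

  WellFormedBasic : BasicImp → Set
  WellFormedBasic b =
    ¬ (BasicImp.lhs b ≡ []) × Consistent (BasicImp.lhs b) ×
    (∀ M → M ∈ BasicImp.rhs b → ¬ (M ≡ []) × Consistent M)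

  record BasicTheory : Set₁ where
    field
      member : BasicImp → Set
      wf     : ∀ b → member b → WellFormedBasic b

  data Label : Set where
    clause : Clause → Label
    star   : Label

  isStar : Label → Bool
  isStar (clause _) = false
  isStar star = true

  data Tree : Set where
    node : Label → List (W × Tree) → Tree

  label : Tree → Label
  label (node ℓ _) = ℓ

  children : Tree → List (W × Tree)
  children (node _ ch) = ch

  Forest : Set
  Forest = List Tree

  data _⊑_ : Tree → Tree → Set where
    here  : ∀ {t} → t ⊑ t
    there : ∀ {s t ℓ ch c} → (c , t) ∈ ch → s ⊑ t → s ⊑ node ℓ ch

  NodeOf : Tree → Forest → Set
  NodeOf s F = ∃[ t ] (t ∈ F × s ⊑ t)

  -- Branch t s w : a maximal path from the root of t to a leaf; s records
  -- whether it contains ⊛, w is the sum of its edge weights.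
  data Branch : Tree → Bool → W → Set where
    leaf : ∀ {ℓ} → Branch (node ℓ []) (isStar ℓ) 0#
    step : ∀ {ℓ ch c t s w} → (c , t) ∈ ch → Branch t s w →
           Branch (node ℓ ch) (isStar ℓ ∨ s) (c + w)

  branchLength : Bool → W → W
  branchLength true  _ = 0#
  branchLength false w = w

  TerminalClause : Forest → Clause → Set
  TerminalClause F L = NodeOf (node (clause L) []) F

  RootClause : Forest → Clause → Set
  RootClause F L = ∃[ ch ] (node (clause L) ch ∈ F)

  ChildClauseWithin : List (W × Tree) → W → (Clause → Set) → Set
  ChildClauseWithin ch c P = ∃[ L' ] ∃[ ch' ] ((c , node (clause L') ch') ∈ ch × P L')

  module _ (T : BasicTheory) where
    open BasicTheory T

    RuleA : Clause → List (W × Tree) → W → Set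
    RuleA L ch c = c ≡ 0# × (∃[ b ] (member b × BasicImp.weight b ≡ 0# ×
      BasicImp.lhs b ⊆ L ×
      (∀ M → M ∈ BasicImp.rhs b → ChildClauseWithin ch c (λ L' → L' ⊆ M ++ L))))

    RuleB : Clause → List (W × Tree) → W → Set
    RuleB L ch c = Positive c × (∃[ b ] (member b × BasicImp.weight b ≡ c ×
      BasicImp.lhs b ⊆ L ×
      (∀ M → M ∈ BasicImp.rhs b → ChildClauseWithin ch c (λ L' → L' ⊆ M))))

    RuleC : Clause → List (W × Tree) → W → Set
    RuleC L ch c = c ≡ 0# × Inconsistent L ×
      (∃[ chs ] (ch ≡ (c , node star chs) ∷ []))

    SplitChild : Lit → Clause → Tree → Set
    SplitChild l L t = ∃[ L₁ ] (label t ≡ clause L₁ × l ∈ L₁ × L₁ ⊆ l ∷ L)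

    RuleD : Clause → List (W × Tree) → W → Set
    RuleD L ch c = c ≡ 0# × (∃[ φ ] ∃[ t₁ ] ∃[ t₂ ]
      ((ch ≡ (c , t₁) ∷ (c , t₂) ∷ [] ⊎ ch ≡ (c , t₂) ∷ (c , t₁) ∷ []) ×
       SplitChild (pos φ) L t₁ × SplitChild (neg φ) L t₂))

    LocalRule : Clause → List (W × Tree) → Set
    LocalRule L ch = ∃[ c ] ((∀ {w t} → (w , t) ∈ ch → w ≡ c) ×
      (RuleA L ch c ⊎ RuleB L ch c ⊎ RuleC L ch c ⊎ RuleD L ch c))

    IsForestProof : Forest → GradedImp → Set
    IsForestProof F (ζ ⇒[ r ] η) =
      (∃[ Bζ ] (ClauseSetFor Bζ ζ ×
        (∀ C → C ∈ Bζ → ∃[ R ] (RootClause F R × R ⊆ C)))) ×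
      (∃[ Bη ] (ClauseSetFor Bη η ×
        (∀ L → TerminalClause F L → ∃[ C ] (C ∈ Bη × C ⊆ L)))) ×
      (∀ t → t ∈ F → ∀ s w → Branch t s w → branchLength s w ≤ r) ×
      (∀ L ch → NodeOf (node (clause L) ch) F → ¬ (ch ≡ []) → LocalRule L ch)

    HasForestProof : GradedImp → Set
    HasForestProof g = ∃[ F ] IsForestProof F g

-- Put ζ and η in disjunctive normal form, dnf ζ and dnf η; each
-- literal of these clause sets comes from an occurrence of matching
-- polarity.  The new forest has one tree per clause C of dnf ζ.  Stage 1
-- splits C on all variables of the given clause set Bζ (rule D); a reached
-- clause A either contains a root of the old forest, whose subtree is then
-- continued with A as its root (the rules are monotone in the clause), or
-- is inconsistent (its valuation would otherwise satisfy ζ, hence f(Bζ))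
-- and is closed by ⊛.  Stage 2 splits every terminal clause on all
-- variables of dnf η; a reached clause either contains a clause l ∷ C of
-- dnf η and one more split on l isolates the leaf l ∷ C, or it is
-- inconsistent.  All new edges have weight 0, so lengths are preserved.
-- If [] ∈ dnf η the single leaf [] already is such a proof.

module Submission where

open import Defs
open import Data.Nat using (ℕ; _≟_)
open import Data.Bool using (Bool; true; false; not; _∧_; _∨_)
open import Data.Bool.Properties
  using (∧-conicalˡ; ∧-conicalʳ; ∧-assoc; ∧-zeroʳ; ∧-identityʳ; ∧-distribˡ-∨; ∧-distribʳ-∨;
         ∨-assoc; ∨-zeroʳ; ∨-identityʳ; not-involutive)
open import Data.List using (List; []; _∷_; _++_; map; concat; cartesianProductWith)
open import Data.List.Properties using (≡-dec)
open import Data.List.Relation.Unary.Any using (Any; here; there; any?)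
open import Data.List.Membership.Propositional using (_∈_; find; lose)
open import Data.List.Membership.Propositional.Properties
  using (∈-++⁻; ∈-map⁺; ∈-map⁻; ∈-concat⁺′; ∈-cartesianProductWith⁻)
open import Data.List.Relation.Binary.Subset.Propositional using (_⊆_)
open import Data.List.Relation.Binary.Subset.Propositional.Properties using (⊆-trans; ∷⁺ʳ; ++⁺ʳ)
open import Data.Product using (∃; ∃-syntax; _×_; _,_; proj₁; proj₂)
open import Data.Sum using (_⊎_; inj₁; inj₂) renaming (map to ⊎-map)
open import Data.Empty using (⊥-elim)
open import Function using (id)
open import Relation.Nullary using (¬_; Dec; yes; no; does)
open import Relation.Nullary.Decidable using (map′)
open import Relation.Binary.Definitions using (DecidableEquality)
open import Relation.Binary.PropositionalEquality
  using (_≡_; refl; sym; trans; cong; cong₂; subst; module ≡-Reasoning)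

_≟ˡ_ : DecidableEquality Lit
pos x ≟ˡ pos y = map′ (cong pos) (λ { refl → refl }) (x ≟ y)
neg x ≟ˡ neg y = map′ (cong neg) (λ { refl → refl }) (x ≟ y)
pos _ ≟ˡ neg _ = no λ ()
neg _ ≟ˡ pos _ = no λ ()

open import Data.List.Membership.DecPropositional _≟ˡ_ using (_∈?_)
open import Data.List.Relation.Binary.Subset.DecPropositional _≟ˡ_ using (_⊆?_)

Clash : Clause → Lit → Set
Clash A l = ∃[ φ ] (l ≡ pos φ × neg φ ∈ A)

clash? : ∀ A l → Dec (Clash A l)
clash? A (pos φ) = map′ (λ n → φ , refl , n) (λ { (_ , refl , n) → n }) (neg φ ∈? A)
clash? A (neg φ) = no λ { (_ , () , _) }

inconsistent? : (A : Clause) → Dec (Inconsistent A)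
inconsistent? A = map′ fromAny toAny (any? (clash? A) A)
  where
    fromAny : Any (Clash A) A → Inconsistent A
    fromAny a with find a
    ... | _ , p , φ , refl , n = φ , p , n
    toAny : Inconsistent A → Any (Clash A) A
    toAny (φ , p , n) = lose p (φ , refl , n)

Covers : ClauseSet → Clause → Set
Covers B A = ∃[ C ] (C ∈ B × C ⊆ A)

covers? : ∀ B A → Dec (Covers B A)
covers? B A = map′ find (λ (C , m , s) → lose m s) (any? (_⊆? A) B)

hasEmpty? : (B : ClauseSet) → Dec ([] ∈ B)
hasEmpty? B = any? (λ C → ≡-dec _≟ˡ_ [] C) B

covers-mono : ∀ {B A A'} → A ⊆ A' → Covers B A → Covers B A'
covers-mono s (C , m , s') = C , m , ⊆-trans s' s

conj-true⁺ : ∀ v C → (∀ {l} → l ∈ C → eval v (litF l) ≡ true) → eval v (conjF C) ≡ true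
conj-true⁺ v [] h = refl
conj-true⁺ v (l ∷ C) h = cong₂ _∧_ (h (here refl)) (conj-true⁺ v C (λ m → h (there m)))

conj-true⁻ : ∀ v C {l} → eval v (conjF C) ≡ true → l ∈ C → eval v (litF l) ≡ true
conj-true⁻ v (l ∷ C) e (here refl) = ∧-conicalˡ _ _ e
conj-true⁻ v (l ∷ C) e (there m) = conj-true⁻ v C (∧-conicalʳ _ _ e) m

fB-true⁺ : ∀ v B {C} → C ∈ B → eval v (conjF C) ≡ true → eval v (fB B) ≡ true
fB-true⁺ v (C ∷ B) (here refl) e = cong (_∨ eval v (fB B)) e
fB-true⁺ v (C ∷ B) (there m) e =
  trans (cong (eval v (conjF C) ∨_) (fB-true⁺ v B m e)) (∨-zeroʳ _)

fB-true⁻ : ∀ v B → eval v (fB B) ≡ true → ∃[ C ] (C ∈ B × eval v (conjF C) ≡ true)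
fB-true⁻ v (C ∷ B) e with eval v (conjF C) in eC
... | true = C , here refl , eC
... | false with fB-true⁻ v B e
...   | C' , m , e' = C' , there m , e'

clauseVal : Clause → ℕ → Bool
clauseVal A φ = does (pos φ ∈? A)

litVar : Lit → ℕ
litVar (pos φ) = φ
litVar (neg φ) = φ

Decides : Clause → ℕ → Set
Decides A φ = pos φ ∈ A ⊎ neg φ ∈ A

Total : List ℕ → Clause → Set
Total V A = ∀ φ → φ ∈ V → Decides A φ

vars : ClauseSet → List ℕ
vars B = concat (map (map litVar) B)

vars-∈ : ∀ {B C l} → C ∈ B → l ∈ C → litVar l ∈ vars B
vars-∈ m lm = ∈-concat⁺′ (∈-map⁺ litVar lm) (∈-map⁺ (map litVar) m)

clauseVal-sound : ∀ {A l} → Consistent A → l ∈ A → eval (clauseVal A) (litF l) ≡ true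
clauseVal-sound {A} {pos φ} c m with pos φ ∈? A
... | yes _ = refl
... | no ∉ = ⊥-elim (∉ m)
clauseVal-sound {A} {neg φ} c m with pos φ ∈? A
... | yes p = ⊥-elim (c (φ , p , m))
... | no _ = refl

clauseVal-complete : ∀ {A l} → Decides A (litVar l) → eval (clauseVal A) (litF l) ≡ true → l ∈ A
clauseVal-complete {A} {pos φ} _ e with pos φ ∈? A
... | yes p = p
clauseVal-complete {A} {neg φ} (inj₂ n) e = n
clauseVal-complete {A} {neg φ} (inj₁ p) e with pos φ ∈? A
... | no ∉ = ⊥-elim (∉ p)

-- Two clause sets defining the same formula: a consistent clause that
-- covers the first and decides all variables of the second covers the
-- second (evaluate both under the valuation of the clause).
covers-transfer : ∀ {B B' A} → (∀ v → eval v (fB B) ≡ eval v (fB B')) →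
  Consistent A → Total (vars B') A → Covers B A → Covers B' A
covers-transfer {B} {B'} {A} same c total (C , m , C⊆A)
  with fB-true⁻ (clauseVal A) B' (trans (sym (same (clauseVal A))) B-true)
  where
    B-true : eval (clauseVal A) (fB B) ≡ true
    B-true = fB-true⁺ _ B m (conj-true⁺ _ C (λ l∈C → clauseVal-sound c (C⊆A l∈C)))
... | C' , m' , C'-true =
  C' , m' , λ l∈C' → clauseVal-complete (total _ (vars-∈ m' l∈C')) (conj-true⁻ _ C' C'-true l∈C')

-- Disjunctive normal form.  dnf true a is a clause set for a and
-- dnf false a one for ¬a; products distribute a conjunction of
-- disjunctions of clauses.
signed : Bool → Formula → Formula
signed true a = a
signed false a = ¬ᶠ a

_⊗_ : ClauseSet → ClauseSet → ClauseSet
_⊗_ = cartesianProductWith _++_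

dnf : Bool → Formula → ClauseSet
dnf true (fvar φ) = (pos φ ∷ []) ∷ []
dnf false (fvar φ) = (neg φ ∷ []) ∷ []
dnf true fbot = []
dnf false fbot = [] ∷ []
dnf true ftop = [] ∷ []
dnf false ftop = []
dnf true (a ∧ᶠ b) = dnf true a ⊗ dnf true b
dnf false (a ∧ᶠ b) = dnf false a ++ dnf false b
dnf true (a ∨ᶠ b) = dnf true a ++ dnf true b
dnf false (a ∨ᶠ b) = dnf false a ⊗ dnf false b
dnf p (¬ᶠ a) = dnf (not p) a

fB-++ : ∀ v B₁ B₂ → eval v (fB (B₁ ++ B₂)) ≡ eval v (fB B₁) ∨ eval v (fB B₂)
fB-++ v [] B₂ = refl
fB-++ v (C ∷ B₁) B₂ =
  trans (cong (eval v (conjF C) ∨_) (fB-++ v B₁ B₂)) (sym (∨-assoc (eval v (conjF C)) _ _))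

conjF-++ : ∀ v C₁ C₂ → eval v (conjF (C₁ ++ C₂)) ≡ eval v (conjF C₁) ∧ eval v (conjF C₂)
conjF-++ v [] C₂ = refl
conjF-++ v (l ∷ C₁) C₂ =
  trans (cong (eval v (litF l) ∧_) (conjF-++ v C₁ C₂)) (sym (∧-assoc (eval v (litF l)) _ _))

fB-prefix : ∀ v C B → eval v (fB (map (C ++_) B)) ≡ eval v (conjF C) ∧ eval v (fB B)
fB-prefix v C [] = sym (∧-zeroʳ _)
fB-prefix v C (C' ∷ B) =
  trans (cong₂ _∨_ (conjF-++ v C C') (fB-prefix v C B)) (sym (∧-distribˡ-∨ (eval v (conjF C)) _ _))

fB-⊗ : ∀ v B₁ B₂ → eval v (fB (B₁ ⊗ B₂)) ≡ eval v (fB B₁) ∧ eval v (fB B₂)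
fB-⊗ v [] B₂ = refl
fB-⊗ v (C ∷ B₁) B₂ = begin
  eval v (fB (map (C ++_) B₂ ++ B₁ ⊗ B₂))
    ≡⟨ fB-++ v (map (C ++_) B₂) (B₁ ⊗ B₂) ⟩
  eval v (fB (map (C ++_) B₂)) ∨ eval v (fB (B₁ ⊗ B₂))
    ≡⟨ cong₂ _∨_ (fB-prefix v C B₂) (fB-⊗ v B₁ B₂) ⟩
  (eval v (conjF C) ∧ eval v (fB B₂)) ∨ (eval v (fB B₁) ∧ eval v (fB B₂))
    ≡⟨ sym (∧-distribʳ-∨ (eval v (fB B₂)) (eval v (conjF C)) (eval v (fB B₁))) ⟩
  (eval v (conjF C) ∨ eval v (fB B₁)) ∧ eval v (fB B₂) ∎
  where open ≡-Reasoning

not-∧ : ∀ a b → not (a ∧ b) ≡ not a ∨ not b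
not-∧ true b = refl
not-∧ false b = refl

not-∨ : ∀ a b → not (a ∨ b) ≡ not a ∧ not b
not-∨ true b = refl
not-∨ false b = refl

single : ∀ b → (b ∧ true) ∨ false ≡ b
single b = trans (∨-identityʳ _) (∧-identityʳ b)

dnf-correct : ∀ v p a → eval v (fB (dnf p a)) ≡ eval v (signed p a)
dnf-correct v true (fvar φ) = single (v φ)
dnf-correct v false (fvar φ) = single (not (v φ))
dnf-correct v true fbot = refl
dnf-correct v false fbot = refl
dnf-correct v true ftop = refl
dnf-correct v false ftop = refl
dnf-correct v true (a ∧ᶠ b) =
  trans (fB-⊗ v (dnf true a) (dnf true b)) (cong₂ _∧_ (dnf-correct v true a) (dnf-correct v true b))
dnf-correct v false (a ∧ᶠ b) =
  trans (fB-++ v (dnf false a) (dnf false b))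
        (trans (cong₂ _∨_ (dnf-correct v false a) (dnf-correct v false b)) (sym (not-∧ (eval v a) (eval v b))))
dnf-correct v true (a ∨ᶠ b) =
  trans (fB-++ v (dnf true a) (dnf true b)) (cong₂ _∨_ (dnf-correct v true a) (dnf-correct v true b))
dnf-correct v false (a ∨ᶠ b) =
  trans (fB-⊗ v (dnf false a) (dnf false b))
        (trans (cong₂ _∧_ (dnf-correct v false a) (dnf-correct v false b)) (sym (not-∨ (eval v a) (eval v b))))
dnf-correct v true (¬ᶠ a) = dnf-correct v false a
dnf-correct v false (¬ᶠ a) = trans (dnf-correct v true a) (sym (not-involutive (eval v a)))

dnf-clauseSet : ∀ a → ClauseSetFor (dnf true a) a
dnf-clauseSet a v = dnf-correct v true a

LitOcc : Bool → Formula → Lit → Set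
LitOcc p a (pos φ) = Occ p φ a
LitOcc p a (neg φ) = Occ (not p) φ a

litOcc-map : ∀ {a b} → (∀ {q φ} → Occ q φ a → Occ q φ b) → ∀ {p} l → LitOcc p a l → LitOcc p b l
litOcc-map f (pos φ) o = f o
litOcc-map f (neg φ) o = f o

litOcc-¬ : ∀ {a} p l → LitOcc (not p) a l → LitOcc p (¬ᶠ a) l
litOcc-¬ p (pos φ) o = occ-¬ o
litOcc-¬ p (neg φ) o = occ-¬ o

dnf-polarity : ∀ p a {C l} → C ∈ dnf p a → l ∈ C → LitOcc p a l
dnf-polarity true (fvar φ) (here refl) (here refl) = occ-var
dnf-polarity false (fvar φ) (here refl) (here refl) = occ-var
dnf-polarity true (fvar φ) (here refl) (there ())
dnf-polarity false (fvar φ) (here refl) (there ())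
dnf-polarity false fbot (here refl) ()
dnf-polarity true ftop (here refl) ()
dnf-polarity true (a ∧ᶠ b) {l = l} m l∈C
  with ∈-cartesianProductWith⁻ _++_ (dnf true a) (dnf true b) m
... | C₁ , C₂ , m₁ , m₂ , refl with ∈-++⁻ C₁ l∈C
...   | inj₁ l∈C₁ = litOcc-map occ-∧ˡ l (dnf-polarity true a m₁ l∈C₁)
...   | inj₂ l∈C₂ = litOcc-map occ-∧ʳ l (dnf-polarity true b m₂ l∈C₂)
dnf-polarity false (a ∧ᶠ b) {l = l} m l∈C with ∈-++⁻ (dnf false a) m
... | inj₁ mₐ = litOcc-map occ-∧ˡ l (dnf-polarity false a mₐ l∈C)
... | inj₂ mᵦ = litOcc-map occ-∧ʳ l (dnf-polarity false b mᵦ l∈C)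
dnf-polarity true (a ∨ᶠ b) {l = l} m l∈C with ∈-++⁻ (dnf true a) m
... | inj₁ mₐ = litOcc-map occ-∨ˡ l (dnf-polarity true a mₐ l∈C)
... | inj₂ mᵦ = litOcc-map occ-∨ʳ l (dnf-polarity true b mᵦ l∈C)
dnf-polarity false (a ∨ᶠ b) {l = l} m l∈C
  with ∈-cartesianProductWith⁻ _++_ (dnf false a) (dnf false b) m
... | C₁ , C₂ , m₁ , m₂ , refl with ∈-++⁻ C₁ l∈C
...   | inj₁ l∈C₁ = litOcc-map occ-∨ˡ l (dnf-polarity false a m₁ l∈C₁)
...   | inj₂ l∈C₂ = litOcc-map occ-∨ʳ l (dnf-polarity false b m₂ l∈C₂)
dnf-polarity true (¬ᶠ a) {l = l} m l∈C = litOcc-¬ true l (dnf-polarity false a m l∈C)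
dnf-polarity false (¬ᶠ a) {l = l} m l∈C = litOcc-¬ false l (dnf-polarity true a m l∈C)

module Surgery (Wt : Weights) (T : WithWeights.BasicTheory Wt) where
  open Weights Wt
  open WithWeights Wt

  record Sound (P : Clause → Set) (r : W) (t : Tree) : Set where
    field
      rules    : ∀ {L ch} → node (clause L) ch ⊑ t → ¬ ch ≡ [] → LocalRule T L ch
      leaves   : ∀ {L} → node (clause L) [] ⊑ t → P L
      branches : ∀ {s w} → Branch t s w → branchLength s w ≤ r
  open Sound

  leaf-sound : ∀ {P r L} → P L → Sound P r (node (clause L) [])
  rules (leaf-sound p) here ne = ⊥-elim (ne refl)
  rules (leaf-sound p) (there () _)
  leaves (leaf-sound p) here = p
  leaves (leaf-sound p) (there () _)
  branches (leaf-sound {r = r} p) leaf = 0≤ r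

  star-leaf-sound : ∀ {P r} → Sound P r (node star [])
  rules star-leaf-sound (there () _)
  leaves star-leaf-sound (there () _)
  branches (star-leaf-sound {r = r}) leaf = 0≤ r

  node-sound : ∀ {P r A ch} → ¬ ch ≡ [] → LocalRule T A ch →
    (∀ {c t} → (c , t) ∈ ch → c ≡ 0# × Sound P r t) → Sound P r (node (clause A) ch)
  rules (node-sound ne rule kids) here _ = rule
  rules (node-sound ne rule kids) (there m q) = rules (proj₂ (kids m)) q
  leaves (node-sound ne rule kids) here = ⊥-elim (ne refl)
  leaves (node-sound ne rule kids) (there m q) = leaves (proj₂ (kids m)) q
  branches (node-sound ne rule kids) leaf = ⊥-elim (ne refl)
  branches (node-sound {r = r} ne rule kids) {s} (step m b) with kids m
  ... | refl , sound = subst (λ w → branchLength s w ≤ r) (sym (+-identityˡ _)) (branches sound b)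

  starChildren : List (W × Tree)
  starChildren = (0# , node star []) ∷ []

  star-sound : ∀ {P r A} → Inconsistent A → Sound P r (node (clause A) starChildren)
  star-sound {A = A} i = node-sound (λ ()) rule λ { (here refl) → refl , star-leaf-sound }
    where
      rule : LocalRule T A starChildren
      rule = 0# , (λ { (here refl) → refl }) , inj₂ (inj₂ (inj₁ (refl , i , [] , refl)))

  flip : Lit → Lit
  flip (pos φ) = neg φ
  flip (neg φ) = pos φ

  split-node-sound : ∀ {P r A t₁ t₂} l → SplitChild T l A t₁ → SplitChild T (flip l) A t₂ →
    Sound P r t₁ → Sound P r t₂ → Sound P r (node (clause A) ((0# , t₁) ∷ (0# , t₂) ∷ []))
  split-node-sound l sp₁ sp₂ s₁ s₂ = node-sound (λ ()) (rule l sp₁ sp₂)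
    λ { (here refl) → refl , s₁ ; (there (here refl)) → refl , s₂ }
    where
      zero : ∀ {t₁ t₂ w t} → (w , t) ∈ ((0# , t₁) ∷ (0# , t₂) ∷ []) → w ≡ 0#
      zero (here refl) = refl
      zero (there (here refl)) = refl
      rule : ∀ {A t₁ t₂} l → SplitChild T l A t₁ → SplitChild T (flip l) A t₂ →
        LocalRule T A ((0# , t₁) ∷ (0# , t₂) ∷ [])
      rule (pos φ) sp₁ sp₂ = 0# , zero , inj₂ (inj₂ (inj₂ (refl , φ , _ , _ , inj₁ refl , sp₁ , sp₂)))
      rule (neg φ) sp₁ sp₂ = 0# , zero , inj₂ (inj₂ (inj₂ (refl , φ , _ , _ , inj₂ refl , sp₂ , sp₁)))

  splitChildren : List ℕ → Clause → (Clause → List (W × Tree)) → List (W × Tree)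
  splitChildren [] A k = k A
  splitChildren (φ ∷ V) A k =
    (0# , node (clause (pos φ ∷ A)) (splitChildren V (pos φ ∷ A) k)) ∷
    (0# , node (clause (neg φ ∷ A)) (splitChildren V (neg φ ∷ A) k)) ∷ []

  Final : List ℕ → Clause → Clause → Set
  Final V A A' = A ⊆ A' × Total V A'

  final-∷ : ∀ {V A A'} l → Final V (l ∷ A) A' → Final (litVar l ∷ V) A A'
  final-∷ l (sub , total) = (λ m → sub (there m)) , λ
    { _ (here refl) → decides l (sub (here refl)) ; φ (there m) → total φ m }
    where
      decides : ∀ {A'} l → l ∈ A' → Decides A' (litVar l)
      decides (pos φ) = inj₁
      decides (neg φ) = inj₂

  split-sound : ∀ {P r} V A k → (∀ A' → Final V A A' → Sound P r (node (clause A') (k A'))) →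
    Sound P r (node (clause A) (splitChildren V A k))
  split-sound [] A k final = final A (id , λ _ ())
  split-sound (φ ∷ V) A k final = split-node-sound (pos φ)
    (pos φ ∷ A , refl , here refl , id) (neg φ ∷ A , refl , here refl , id)
    (split-sound V (pos φ ∷ A) k λ A' f → final A' (final-∷ (pos φ) f))
    (split-sound V (neg φ ∷ A) k λ A' f → final A' (final-∷ (neg φ) f))

  -- A clause node containing the nonempty clause l ∷ C is closed by
  -- splitting on l: the l-child is the leaf l ∷ C, the other child
  -- contains both l and its complement.
  closeChildren : Lit → Clause → Clause → List (W × Tree)
  closeChildren l C A = (0# , node (clause (l ∷ C)) []) ∷ (0# , node (clause (flip l ∷ A)) starChildren) ∷ []

  close-sound : ∀ {P r l C A} → (l ∷ C) ⊆ A → P (l ∷ C) → Sound P r (node (clause A) (closeChildren l C A))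
  close-sound {l = l} {C} {A} sub p = split-node-sound l
    (l ∷ C , refl , here refl , ∷⁺ʳ l (λ m → sub (there m)))
    (flip l ∷ A , refl , here refl , id)
    (leaf-sound p) (star-sound (clash l (sub (here refl))))
    where
      clash : ∀ {A} l → l ∈ A → Inconsistent (flip l ∷ A)
      clash (pos φ) m = φ , there m , here refl
      clash (neg φ) m = φ , here refl , there m

  localRule-mono : ∀ {L A ch} → L ⊆ A → LocalRule T L ch → LocalRule T A ch
  localRule-mono s (c , same , inj₁ (c0 , b , mem , w0 , lhs , kids)) =
    c , same , inj₁ (c0 , b , mem , w0 , ⊆-trans lhs s , λ M mM → widen M (kids M mM))
    where
      widen : ∀ M → ChildClauseWithin _ c (λ L' → L' ⊆ M ++ _) → ChildClauseWithin _ c (λ L' → L' ⊆ M ++ _)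
      widen M (L' , ch' , m , sub) = L' , ch' , m , ⊆-trans sub (++⁺ʳ M s)
  localRule-mono s (c , same , inj₂ (inj₁ (pc , b , mem , wc , lhs , kids))) =
    c , same , inj₂ (inj₁ (pc , b , mem , wc , ⊆-trans lhs s , kids))
  localRule-mono s (c , same , inj₂ (inj₂ (inj₁ (c0 , (φ , p , n) , only⊛)))) =
    c , same , inj₂ (inj₂ (inj₁ (c0 , (φ , s p , s n) , only⊛)))
  localRule-mono s (c , same , inj₂ (inj₂ (inj₂ (c0 , φ , t₁ , t₂ , e , sp₁ , sp₂)))) =
    c , same , inj₂ (inj₂ (inj₂ (c0 , φ , t₁ , t₂ , e , widen {t = t₁} sp₁ , widen {t = t₂} sp₂)))
    where
      widen : ∀ {l t} → SplitChild T l _ t → SplitChild T l _ t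
      widen {l} (L₁ , lab , l∈L₁ , sub) = L₁ , lab , l∈L₁ , ⊆-trans sub (∷⁺ʳ l s)

  -- Enlarging the root clause of a sound tree keeps it sound, provided the
  -- leaf condition is upward closed (it matters only if the root is a leaf).
  UpwardClosed : (Clause → Set) → Set
  UpwardClosed P = ∀ {L L'} → L ⊆ L' → P L → P L'

  root-mono : ∀ {P r R A ch} → UpwardClosed P → R ⊆ A →
    Sound P r (node (clause R) ch) → Sound P r (node (clause A) ch)
  rules (root-mono up s sound) here ne = localRule-mono s (rules sound here ne)
  rules (root-mono up s sound) (there m q) = rules sound (there m q)
  leaves (root-mono up s sound) here = up s (leaves sound here)
  leaves (root-mono up s sound) (there m q) = leaves sound (there m q)
  branches (root-mono up s sound) leaf = branches sound leaf
  branches (root-mono up s sound) (step m b) = branches sound (step m b)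

  module Graft (g : Clause → List (W × Tree)) where
    leafChildren : Label → List (W × Tree)
    leafChildren (clause L) = g L
    leafChildren star = []

    mutual
      graft : Tree → Tree
      graft (node ℓ []) = node ℓ (leafChildren ℓ)
      graft (node ℓ (e ∷ ch)) = node ℓ (graftAll (e ∷ ch))

      graftAll : List (W × Tree) → List (W × Tree)
      graftAll [] = []
      graftAll ((c , t) ∷ ch) = (c , graft t) ∷ graftAll ch

    graftAll-∈⁺ : ∀ {ch c t} → (c , t) ∈ ch → (c , graft t) ∈ graftAll ch
    graftAll-∈⁺ (here refl) = here refl
    graftAll-∈⁺ (there m) = there (graftAll-∈⁺ m)

    graftAll-∈⁻ : ∀ ch {c t'} → (c , t') ∈ graftAll ch → ∃[ t ] ((c , t) ∈ ch × t' ≡ graft t)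
    graftAll-∈⁻ ((c , t) ∷ ch) (here refl) = t , here refl , refl
    graftAll-∈⁻ (_ ∷ ch) (there m) with graftAll-∈⁻ ch m
    ... | t , m' , e = t , there m' , e

    graft-root : ∀ ℓ ch → ∃[ ch' ] (graft (node ℓ ch) ≡ node ℓ ch')
    graft-root ℓ [] = leafChildren ℓ , refl
    graft-root ℓ (e ∷ ch) = graftAll (e ∷ ch) , refl

    graft-label : ∀ t → label (graft t) ≡ label t
    graft-label (node ℓ ch) = cong label (proj₂ (graft-root ℓ ch))

    -- The rules only inspect edge weights and the labels of the children,
    -- so they survive grafting below the children.
    graft-rule : ∀ {L ch} → LocalRule T L ch → LocalRule T L (graftAll ch)
    graft-rule {L} {ch} (c , same , rule) = c , same' , ⊎-map ruleA (⊎-map ruleB (⊎-map ruleC ruleD)) rule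
      where
        same' : ∀ {w t} → (w , t) ∈ graftAll ch → w ≡ c
        same' m with graftAll-∈⁻ ch m
        ... | _ , m' , _ = same m'
        child : ∀ {P} → ChildClauseWithin ch c P → ChildClauseWithin (graftAll ch) c P
        child (L' , ch' , m , p) with graft-root (clause L') ch'
        ... | ch'' , e = L' , ch'' , subst (λ t → (c , t) ∈ graftAll ch) e (graftAll-∈⁺ m) , p
        ruleA : RuleA T L ch c → RuleA T L (graftAll ch) c
        ruleA (c0 , b , mem , w0 , lhs , kids) = c0 , b , mem , w0 , lhs , λ M mM → child (kids M mM)
        ruleB : RuleB T L ch c → RuleB T L (graftAll ch) c
        ruleB (pc , b , mem , wc , lhs , kids) = pc , b , mem , wc , lhs , λ M mM → child (kids M mM)
        ruleC : RuleC T L ch c → RuleC T L (graftAll ch) c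
        ruleC (c0 , i , chs , refl) with graft-root star chs
        ... | chs' , e = c0 , i , chs' , cong (λ t → (c , t) ∷ []) e
        splitChild : ∀ {l t} → SplitChild T l L t → SplitChild T l L (graft t)
        splitChild {t = t} (L₁ , lab , l∈L₁ , sub) = L₁ , trans (graft-label t) lab , l∈L₁ , sub
        ruleD : RuleD T L ch c → RuleD T L (graftAll ch) c
        ruleD (c0 , φ , t₁ , t₂ , inj₁ refl , sp₁ , sp₂) =
          c0 , φ , graft t₁ , graft t₂ , inj₁ refl , splitChild {t = t₁} sp₁ , splitChild {t = t₂} sp₂
        ruleD (c0 , φ , t₁ , t₂ , inj₂ refl , sp₁ , sp₂) =
          c0 , φ , graft t₁ , graft t₂ , inj₂ refl , splitChild {t = t₁} sp₁ , splitChild {t = t₂} sp₂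

    data GraftedNode (t : Tree) : Tree → Set where
      inner   : ∀ {ℓ c t₁ ch} → node ℓ ((c , t₁) ∷ ch) ⊑ t →
                GraftedNode t (node ℓ (graftAll ((c , t₁) ∷ ch)))
      ⊛-leaf  : node star [] ⊑ t → GraftedNode t (node star [])
      grafted : ∀ {L s} → node (clause L) [] ⊑ t → s ⊑ node (clause L) (g L) → GraftedNode t s

    graftedNode-there : ∀ {ℓ ch c t s} → (c , t) ∈ ch → GraftedNode t s → GraftedNode (node ℓ ch) s
    graftedNode-there m (inner q) = inner (there m q)
    graftedNode-there m (⊛-leaf q) = ⊛-leaf (there m q)
    graftedNode-there m (grafted q q') = grafted (there m q) q'

    graft-node : ∀ t {s} → s ⊑ graft t → GraftedNode t s
    graft-node (node (clause L) []) q = grafted here q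
    graft-node (node star []) here = ⊛-leaf here
    graft-node (node ℓ ((c , t₁) ∷ ch)) here = inner here
    graft-node (node ℓ (e ∷ ch)) (there m q) with graftAll-∈⁻ (e ∷ ch) m
    ... | t , m' , refl = graftedNode-there m' (graft-node t q)

    graft-branch : ∀ {Q} t → (∀ {L} → node (clause L) [] ⊑ t → Sound Q 0# (node (clause L) (g L))) →
      ∀ {s w} → Branch (graft t) s w → s ≡ true ⊎ Branch t s w
    graft-branch (node (clause L) []) zero {true} b = inj₁ refl
    graft-branch (node (clause L) []) zero {false} b = inj₂ (subst (Branch _ false) (sym w≡0) leaf)
      where
        w≡0 : _ ≡ 0#
        w≡0 = ≤-antisym (branches (zero here) b) (0≤ _)
    graft-branch (node star []) zero leaf = inj₁ refl
    graft-branch (node star (e ∷ ch)) zero (step m b) = inj₁ refl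
    graft-branch (node (clause L) (e ∷ ch)) zero (step m b) with graftAll-∈⁻ (e ∷ ch) m
    ... | t , m' , refl = ⊎-map id (step m') (graft-branch t (λ q → zero (there m' q)) b)

    graft-sound : ∀ {P Q r t} → Sound P r t → (∀ L → P L → Sound Q 0# (node (clause L) (g L))) →
      Sound Q r (graft t)
    graft-sound {P} {Q} {r} {t} sound ext = record
      { rules = rules'
      ; leaves = leaves'
      ; branches = branches'
      }
      where
        extend : ∀ {L} → node (clause L) [] ⊑ t → Sound Q 0# (node (clause L) (g L))
        extend q = ext _ (leaves sound q)
        rules' : ∀ {L ch} → node (clause L) ch ⊑ graft t → ¬ ch ≡ [] → LocalRule T L ch
        rules' q ne with graft-node t q
        ... | inner q' = graft-rule (rules sound q' (λ ()))
        ... | grafted q' q'' = rules (extend q') q'' ne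
        leaves' : ∀ {L} → node (clause L) [] ⊑ graft t → Q L
        leaves' q with graft-node t q
        ... | grafted q' q'' = leaves (extend q') q''
        branches' : ∀ {s w} → Branch (graft t) s w → branchLength s w ≤ r
        branches' b with graft-branch t extend b
        ... | inj₁ refl = 0≤ r
        ... | inj₂ b' = branches sound b'

  forest-sound : ∀ {F Bη r} → (∀ L → TerminalClause F L → Covers Bη L) →
    (∀ t → t ∈ F → ∀ s w → Branch t s w → branchLength s w ≤ r) →
    (∀ L ch → NodeOf (node (clause L) ch) F → ¬ ch ≡ [] → LocalRule T L ch) →
    ∀ {t} → t ∈ F → Sound (Covers Bη) r t
  forest-sound T2 T3 T4 m = record
    { rules = λ q → T4 _ _ (_ , m , q) ; leaves = λ q → T2 _ (_ , m , q) ; branches = T3 _ m _ _ }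

  Faithful : Formula → Clause → Set
  Faithful a L = ∀ {l} → l ∈ L → LitOcc true a l

  NormalProof : Formula → W → Formula → Forest → Set
  NormalProof ζ r η F = IsForestProof T F (ζ ⇒[ r ] η) ×
    (∀ L → RootClause F L → Faithful ζ L) × (∀ L → TerminalClause F L → Faithful η L)

  normal-proof : ∀ {ζ r η F Bζ} → ClauseSetFor Bζ ζ →
    (∀ C → C ∈ Bζ → ∃[ R ] (RootClause F R × R ⊆ C)) →
    (∀ L → RootClause F L → Faithful ζ L) →
    (∀ {t} → t ∈ F → Sound (_∈ dnf true η) r t) → NormalProof ζ r η F
  normal-proof {ζ} {r} {η} {F} {Bζ} csζ roots faithful sound =
    ((Bζ , csζ , roots) ,
     (dnf true η , dnf-clauseSet η , λ L (_ , m , q) → L , leaves (sound m) q , id) ,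
     (λ t m s w → branches (sound m)) ,
     (λ L ch (_ , m , q) → rules (sound m) q)) ,
    faithful , λ L (_ , m , q) → dnf-polarity true η (leaves (sound m) q)

  -- If [] ∈ dnf η, the single leaf [] is a normal proof: [] is contained
  -- in every clause of dnf ζ, and it is a clause of dnf η.
  trivial-normal : ∀ {ζ r η} → [] ∈ dnf true η → NormalProof ζ r η (node (clause []) [] ∷ [])
  trivial-normal {ζ} empty = normal-proof {Bζ = dnf true ζ} (dnf-clauseSet ζ)
    (λ C _ → [] , ([] , here refl) , λ ())
    (λ { L (_ , here refl) () ; L (_ , there ()) })
    (λ { (here refl) → leaf-sound empty ; (there ()) })

  module Normalise {ζ r η F₀ Bζ Bη} (csζ : ClauseSetFor Bζ ζ)
      (roots : ∀ C → C ∈ Bζ → ∃[ R ] (RootClause F₀ R × R ⊆ C)) (csη : ClauseSetFor Bη η)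
      (sound₀ : ∀ {t} → t ∈ F₀ → Sound (Covers Bη) r t) (nonempty : ¬ [] ∈ dnf true η) where

    rootStage : ∀ {A} → Dec (Covers Bζ A) → List (W × Tree)
    rootStage (yes (C , m , _)) = proj₁ (proj₁ (proj₂ (roots C m)))
    rootStage (no _) = starChildren

    -- If A extends a clause of dnf ζ and there is no such root, then A is
    -- inconsistent: otherwise its valuation satisfies ζ, hence f(Bζ).
    rootStage-sound : ∀ {C₀ A} → C₀ ∈ dnf true ζ → Final (vars Bζ) C₀ A →
      (d : Dec (Covers Bζ A)) → Sound (Covers Bη) r (node (clause A) (rootStage d))
    rootStage-sound _ _ (yes (C , m , C⊆A)) with roots C m
    ... | R , (_ , R∈F₀) , R⊆C = root-mono covers-mono (⊆-trans R⊆C C⊆A) (sound₀ R∈F₀)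
    rootStage-sound {C₀} {A} m₀ (C₀⊆A , total) (no uncovered) with inconsistent? A
    ... | yes i = star-sound i
    ... | no c = ⊥-elim (uncovered (covers-transfer same c total (C₀ , m₀ , C₀⊆A)))
      where
        same : ∀ v → eval v (fB (dnf true ζ)) ≡ eval v (fB Bζ)
        same v = trans (dnf-correct v true ζ) (sym (csζ v))

    leafStage : ∀ {A} → Dec (Covers (dnf true η) A) → List (W × Tree)
    leafStage {A} (yes (l ∷ C , _ , _)) = closeChildren l C A
    leafStage (yes ([] , _ , _)) = []
    leafStage (no _) = starChildren

    -- If A extends a terminal clause of F₀ and contains no clause of dnf η,
    -- then A is inconsistent: otherwise its valuation satisfies f(Bη), hence η.
    leafStage-sound : ∀ {L A} → Covers Bη L → Final (vars (dnf true η)) L A →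
      (d : Dec (Covers (dnf true η) A)) → Sound (_∈ dnf true η) 0# (node (clause A) (leafStage d))
    leafStage-sound _ _ (yes ([] , m , _)) = ⊥-elim (nonempty m)
    leafStage-sound _ _ (yes (l ∷ C , m , sub)) = close-sound sub m
    leafStage-sound {A = A} cov (L⊆A , total) (no uncovered) with inconsistent? A
    ... | yes i = star-sound i
    ... | no c = ⊥-elim (uncovered (covers-transfer same c total (covers-mono L⊆A cov)))
      where
        same : ∀ v → eval v (fB Bη) ≡ eval v (fB (dnf true η))
        same v = trans (csη v) (sym (dnf-correct v true η))

    open Graft (λ L → splitChildren (vars (dnf true η)) L (λ A → leafStage (covers? (dnf true η) A)))

    normalTree : Clause → Tree
    normalTree C = graft (node (clause C) (splitChildren (vars Bζ) C (λ A → rootStage (covers? Bζ A))))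

    normalTree-sound : ∀ {C} → C ∈ dnf true ζ → Sound (_∈ dnf true η) r (normalTree C)
    normalTree-sound {C} m = graft-sound
      (split-sound (vars Bζ) C _ λ A final → rootStage-sound m final (covers? Bζ A))
      (λ L cov → split-sound (vars (dnf true η)) L _ λ A final →
        leafStage-sound cov final (covers? (dnf true η) A))

    normalTree-root : ∀ C → ∃[ ch ] (normalTree C ≡ node (clause C) ch)
    normalTree-root C = graft-root (clause C) _

    normalForest : Forest
    normalForest = map normalTree (dnf true ζ)

    normalForest-sound : ∀ {t} → t ∈ normalForest → Sound (_∈ dnf true η) r t
    normalForest-sound m with ∈-map⁻ normalTree m
    ... | C , mC , refl = normalTree-sound mC

    normalForest-root⁺ : ∀ {C} → C ∈ dnf true ζ → RootClause normalForest C
    normalForest-root⁺ {C} m with normalTree-root C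
    ... | ch , e = ch , subst (_∈ normalForest) e (∈-map⁺ normalTree m)

    normalForest-root⁻ : ∀ {L} → RootClause normalForest L → L ∈ dnf true ζ
    normalForest-root⁻ (ch , m) with ∈-map⁻ normalTree m
    ... | C , mC , e with normalTree-root C
    ...   | ch' , e' with trans e e'
    ...     | refl = mC

    normal : NormalProof ζ r η normalForest
    normal = normal-proof (dnf-clauseSet ζ) (λ C m → C , normalForest-root⁺ m , id)
      (λ L root → dnf-polarity true ζ (normalForest-root⁻ root)) normalForest-sound

  faithful-vars : ∀ {a L} → Faithful a L → ∀ φ →
    (pos φ ∈ L → OccursPositively φ a) × (neg φ ∈ L → OccursNegatively φ a)
  faithful-vars f φ = f , f

  normalise : ∀ {ζ r η} → HasForestProof T (ζ ⇒[ r ] η) → ∃ (NormalProof ζ r η)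
  normalise {η = η} (F₀ , (Bζ , csζ , roots) , (Bη , csη , T2) , T3 , T4) with hasEmpty? (dnf true η)
  ... | yes empty = _ , trivial-normal empty
  ... | no nonempty = _ , Normalise.normal csζ roots csη (forest-sound T2 T3 T4) nonempty

lemma5p3 : (Wt : Weights) → let open WithWeights Wt in
    (T : BasicTheory) (ζ : Formula) (r : Weights.W Wt) (η : Formula) →
    HasForestProof T (ζ ⇒[ r ] η) →
    ∃[ F ] (IsForestProof T F (ζ ⇒[ r ] η) ×
      (∀ L → RootClause F L → ∀ (φ : ℕ) →
        (pos φ ∈ L → OccursPositively φ ζ) × (neg φ ∈ L → OccursNegatively φ ζ)) ×
      (∀ L → TerminalClause F L → ∀ (φ : ℕ) →
        (pos φ ∈ L → OccursPositively φ η) × (neg φ ∈ L → OccursNegatively φ η)))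
lemma5p3 Wt T ζ r η proof₀ with Surgery.normalise Wt T proof₀
... | F , proof , faithful-roots , faithful-leaves =
  F , proof , (λ L root → faithful-vars (faithful-roots L root)) , (λ L leaf → faithful-vars (faithful-leaves L leaf))
  where open Surgery Wt T
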